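{- Let $b\ge1$ be an integer and $G$ a $(b+1)$-degenerate graph, and consider the $(1:b)$ component game on $G$ in which Maker moves first and Breaker plays according to $\mathcal{S}_B$. At any time during the game, let $\Gamma$ be a connected component of Maker's graph and let $C_0$ be an H-comp contained in $\Gamma$ of maximal rank. If every H-comp contained in $\Gamma$ is contracted to a single vertex, the resulting graph $T_\Gamma$ is a tree which, rooted at the vertex corresponding to $C_0$, has height at most $\rho(C_0)$.
   Context: A graph is $(b+1)$-degenerate if it has no nonempty subgraph of minimum degree at least $b+2$. The $(b+2)$-peeling process: $G_0=G$, and $G_{t+1}$ is obtained from $G_t$ by deleting all edges incident with vertices of degree at most $b+1$ in $G_t$ (vertices are kept). The rank of a vertex is $\rho(v)=\min\{t\ge0:\deg_{G_t}(v)<b+2\}$. In the $(1:b)$ component game on $G$, each round consists of a move of Maker, who claims one unclaimed ("free") edge of $G$, followed by a move of Breaker, who claims $b$ free edges one at a time. Maker's graph consists of the edges she has claimed. An edge $uv$ is horizontal if $\rho(u)=\rho(v)$ and vertical otherwise. An H-comp is a connected component (possibly a single vertex) of the graph on $V(G)$ whose edges are the horizontal edges claimed by Maker; its vertices share a rank $\rho(C)$. A vertical edge $e$ is above $C$ if its endpoint of smaller rank lies in $V(C)$. $F(C)$ is the set of free edges of $G_{\rho(C)}$ incident with $V(C)$; $F_V(C)$, $F_H(C)$ are its vertical and horizontal edges. Strategy $\mathcal{S}_B$: when Maker claims $e=uv$ with $\rho(u)\le\rho(v)$, let $C$ be the H-comp containing $u$ after her move; in each of his $b$ steps Breaker claims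 an arbitrary edge of $F_V(C)$ if nonempty, otherwise of $F_H(C)$ if nonempty, otherwise an arbitrary free edge. -}

module Defs where

open import Data.Nat using (ℕ; zero; suc; _+_; _≤_; _<_; _≤ᵇ_; _%_)
open import Data.Nat.DivMod using (m%n<n)
open import Data.Bool using (Bool; true; false; if_then_else_; _∧_)
open import Data.Fin using (Fin; zero; suc; toℕ; fromℕ<)
open import Data.Product using (Σ; _×_; _,_; proj₁; proj₂)
open import Data.Sum using (_⊎_)
open import Data.List using (List; []; _∷_)
open import Data.List.Relation.Unary.Any using (Any)
open import Relation.Binary.PropositionalEquality using (_≡_; _≢_)
open import Relation.Nullary using (¬_)

countF : ∀ {n} → (Fin n → Bool) → ℕ
countF {zero}  f = 0
countF {suc n} f = (if f zero then 1 else 0) + countF (λ i → f (suc i))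

-- A (simple) graph on vertex set Fin n is given by a symmetric,
-- irreflexive Boolean adjacency relation (hypotheses in the statement).
-- Degree of v in the graph with adjacency H.
deg : ∀ {n} → (Fin n → Fin n → Bool) → Fin n → ℕ
deg H v = countF (H v)

-- Edges are represented by ordered pairs; (u,v) and (v,u) denote the same edge.
Edge : ℕ → Set
Edge n = Fin n × Fin n

SameEdge : ∀ {n} → Edge n → Edge n → Set
SameEdge (u , v) (x , y) = (u ≡ x × v ≡ y) ⊎ (u ≡ y × v ≡ x)

_∈ₑ_ : ∀ {n} → Edge n → List (Edge n) → Set
e ∈ₑ L = Any (SameEdge e) L

csuc : ∀ {k} → Fin (suc k) → Fin (suc k)
csuc {k} i = fromℕ< (m%n<n (suc (toℕ i)) (suc k))

module Peel {n : ℕ} (adj : Fin n → Fin n → Bool) (b : ℕ) where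

  -- (b+1)-degenerate: no nonempty subgraph (vertex set S, edge set H)
  -- of minimum degree at least b+2.
  Degenerate : Set
  Degenerate =
    ¬ (Σ (Fin n → Bool) λ S → Σ (Fin n → Fin n → Bool) λ H →
         (∀ x y → H x y ≡ H y x)
       × (∀ x y → H x y ≡ true → adj x y ≡ true × S x ≡ true × S y ≡ true)
       × (Σ (Fin n) λ x → S x ≡ true)
       × (∀ x → S x ≡ true → 2 + b ≤ deg H x))

  peel : ℕ → Fin n → Fin n → Bool
  peel zero    u v = adj u v
  peel (suc t) u v = peel t u v ∧ ((2 + b ≤ᵇ deg (peel t) u) ∧ (2 + b ≤ᵇ deg (peel t) v))

  IsRank : Fin n → ℕ → Set
  IsRank v t = (deg (peel t) v < 2 + b) × (∀ s → s < t → 2 + b ≤ deg (peel s) v)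

module Game {n : ℕ} (adj : Fin n → Fin n → Bool) (b : ℕ) (ρ : Fin n → ℕ) where
  open Peel adj b

  -- M : Maker's edges, B : Breaker's edges (claimed so far)
  Free : List (Edge n) → List (Edge n) → Edge n → Set
  Free M B (x , y) = (adj x y ≡ true) × ¬ ((x , y) ∈ₑ M) × ¬ ((x , y) ∈ₑ B)

  data MReach (M : List (Edge n)) : Fin n → Fin n → Set where
    mhere : ∀ {x} → MReach M x x
    mstep : ∀ {x y z} → MReach M x y → (y , z) ∈ₑ M → MReach M x z

  -- reachability via Maker's horizontal edges (same H-comp)
  data HReach (M : List (Edge n)) : Fin n → Fin n → Set where
    hhere : ∀ {x} → HReach M x x
    hstep : ∀ {x y z} → HReach M x y → (y , z) ∈ₑ M → ρ y ≡ ρ z → HReach M x z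

  -- F(C) for the H-comp C containing u: free edges of G_{ρ(u)} incident with V(C)
  FC : List (Edge n) → List (Edge n) → Fin n → Edge n → Set
  FC M B u (x , y) = Free M B (x , y) × (peel (ρ u) x y ≡ true) × (HReach M u x ⊎ HReach M u y)

  FV FH : List (Edge n) → List (Edge n) → Fin n → Edge n → Set
  FV M B u (x , y) = FC M B u (x , y) × (ρ x ≢ ρ y)
  FH M B u (x , y) = FC M B u (x , y) × (ρ x ≡ ρ y)

  low : Edge n → Fin n
  low (u , v) = if ρ u ≤ᵇ ρ v then u else v

  -- Breaker's move e is allowed by S_B, Maker's last edge being m
  SB : List (Edge n) → List (Edge n) → Edge n → Edge n → Set
  SB M B m e =
      FV M B (low m) e
    ⊎ ((¬ Σ (Edge n) (FV M B (low m))) × FH M B (low m) e)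
    ⊎ ((¬ Σ (Edge n) (FV M B (low m))) × (¬ Σ (Edge n) (FH M B (low m))) × Free M B e)

  data Phase : Set where
    makerTurn : Phase
    breakerTurn : Edge n → ℕ → Phase   -- Maker's edge of this round, Breaker steps left

  afterB : Edge n → ℕ → Phase
  afterB m zero    = makerTurn
  afterB m (suc k) = breakerTurn m (suc k)

  data Reachable : List (Edge n) → List (Edge n) → Phase → Set where
    init : Reachable [] [] makerTurn
    mk   : ∀ {M B e} → Reachable M B makerTurn → Free M B e →
           Reachable (e ∷ M) B (breakerTurn e b)
    bk   : ∀ {M B m k e} → Reachable M B (breakerTurn m (suc k)) → Free M B e →
           SB M B m e → Reachable M (e ∷ B) (afterB m k)

  -- T_Γ : vertices = H-comps (H-classes), edges = Maker's vertical edges.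
  -- Walk of length k in T_Γ from the H-comp of x to the H-comp of y.
  data TWalk (M : List (Edge n)) : Fin n → Fin n → ℕ → Set where
    there0 : ∀ {x y} → HReach M x y → TWalk M x y 0
    tstep  : ∀ {x x' z y k} → HReach M x x' → (x' , z) ∈ₑ M → ρ x' ≢ ρ z →
             TWalk M z y k → TWalk M x y (suc k)

  -- a cycle in the multigraph T_Γ (within the component of c0): k+1 ≥ 1 oriented
  -- vertical Maker edges es i = (x_i , y_i), pairwise distinct, with y_i in the
  -- H-comp of x_{i+1 mod k+1}, and the H-comps of the x_i pairwise distinct.
  Cycle : List (Edge n) → Fin n → Set
  Cycle M c0 = Σ ℕ λ k → Σ (Fin (suc k) → Edge n) λ es →
      MReach M c0 (proj₁ (es zero))
    × (∀ i → es i ∈ₑ M)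
    × (∀ i → ρ (proj₁ (es i)) ≢ ρ (proj₂ (es i)))
    × (∀ i → HReach M (proj₂ (es i)) (proj₁ (es (csuc i))))
    × (∀ i j → i ≢ j → ¬ SameEdge (es i) (es j))
    × (∀ i j → i ≢ j → ¬ HReach M (proj₁ (es i)) (proj₁ (es j)))

  IsTreeTΓ : List (Edge n) → Fin n → Set
  IsTreeTΓ M c0 =
      (∀ x y → MReach M c0 x → MReach M c0 y → Σ ℕ λ k → TWalk M x y k)
    × ¬ Cycle M c0

  HeightAtMost : List (Edge n) → Fin n → ℕ → Set
  HeightAtMost M c0 h = ∀ w → MReach M c0 w → Σ ℕ λ k → k ≤ h × TWalk M c0 w k

{-# OPTIONS --safe #-}
-- Breaker keeps every H-comp C with |F(C)| ≤ b + 1: a lone vertex of rank ρ has degree ≤ b + 1 in G_ρ,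
-- a horizontal Maker edge merges two H-comps into one with at most 2b free edges, of which Breaker then
-- claims b, and a vertical Maker edge above C lies in F(C), so Breaker empties F(C) right away. Every
-- further vertical edge above C would also lie in F(C), hence each H-comp has at most one Maker edge
-- above it. In T_Γ every H-comp other than the top one C₀ therefore has a unique parent of higher rank:
-- T_Γ is a tree, and each step towards C₀ raises the rank, bounding the height by ρ(C₀).
module Submission where

open import Defs
open import Level using (0ℓ)
open import Data.Nat using (ℕ; zero; suc; _+_; _≤_; _<_; _≤ᵇ_; _%_; z≤n; s≤s)
open import Data.Nat.Properties
open import Data.Nat.DivMod using (n%n≡0; m<n⇒m%n≡m)
open import Data.Bool using (Bool; true; false; _∧_; T)
open import Data.Bool.Properties using (T-≡; ∧-comm)
open import Data.Fin using (Fin; zero; suc; toℕ; fromℕ; inject₁)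
open import Data.Fin.Properties as Fin using (toℕ-injective; toℕ-fromℕ<; toℕ-fromℕ; toℕ-inject₁; toℕ<n)
open import Data.Product using (Σ; _×_; _,_; proj₁; proj₂)
open import Data.Sum as Sum using (_⊎_; inj₁; inj₂)
open import Data.Unit using (tt)
open import Data.List using (List; []; _∷_; _++_; length; map; filter; allFin)
open import Data.List.Properties using (length-map; length-++; filter-++; filter-notAll)
open import Data.List.Relation.Unary.Any as Any using (here; there)
import Data.List.Relation.Unary.All as All
open import Data.List.Relation.Unary.Any.Properties using (++⁺ˡ; ++⁺ʳ)
open import Data.List.Membership.Propositional using (_∈_)
open import Data.List.Membership.Propositional.Properties using (∈-map⁺; ∈-allFin)
open import Data.List.Membership.Setoid.Properties using (∈-resp-≈; ∈-filter⁺)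
open import Data.List.Extrema.Nat using (argmin; f[argmin]≤f[xs])
open import Data.Empty using (⊥; ⊥-elim)
open import Function using (_∘_)
open import Function.Bundles using (Equivalence)
open import Relation.Nullary using (¬_; Dec; yes; no; ¬?)
open import Relation.Nullary.Decidable using (map′; _×-dec_; _⊎-dec_)
open import Relation.Binary.Bundles using (Setoid)
open import Relation.Binary.Definitions using (tri<; tri≈; tri>)
open import Relation.Binary.PropositionalEquality

SameEdge-refl : ∀ {n} {u v : Fin n} → SameEdge (u , v) (u , v)
SameEdge-refl = inj₁ (refl , refl)

SameEdge-swap : ∀ {n} {u v : Fin n} → SameEdge (u , v) (v , u)
SameEdge-swap = inj₂ (refl , refl)

SameEdge-sym : ∀ {n} {u v x y : Fin n} → SameEdge (u , v) (x , y) → SameEdge (x , y) (u , v)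
SameEdge-sym (inj₁ (refl , refl)) = SameEdge-refl
SameEdge-sym (inj₂ (refl , refl)) = SameEdge-swap

SameEdge-trans : ∀ {n} {u v x y s t : Fin n} →
                 SameEdge (u , v) (x , y) → SameEdge (x , y) (s , t) → SameEdge (u , v) (s , t)
SameEdge-trans (inj₁ (refl , refl)) q = q
SameEdge-trans (inj₂ (refl , refl)) (inj₁ (refl , refl)) = SameEdge-swap
SameEdge-trans (inj₂ (refl , refl)) (inj₂ (refl , refl)) = SameEdge-refl

_≟ₑ_ : ∀ {n} (e f : Edge n) → Dec (SameEdge e f)
(u , v) ≟ₑ (x , y) = ((u Fin.≟ x) ×-dec (v Fin.≟ y)) ⊎-dec ((u Fin.≟ y) ×-dec (v Fin.≟ x))

edgeSetoid : ℕ → Setoid 0ℓ 0ℓ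
edgeSetoid n = record
  { Carrier = Edge n
  ; _≈_ = SameEdge
  ; isEquivalence = record { refl = SameEdge-refl ; sym = SameEdge-sym ; trans = SameEdge-trans }
  }

∈ₑ-swap : ∀ {n} {u v : Fin n} {L : List (Edge n)} → (u , v) ∈ₑ L → (v , u) ∈ₑ L
∈ₑ-swap = ∈-resp-≈ (edgeSetoid _) SameEdge-swap

∈⇒∈ₑ : ∀ {n} {e : Edge n} {L : List (Edge n)} → e ∈ L → e ∈ₑ L
∈⇒∈ₑ = Any.map λ { refl → SameEdge-refl }

without : ∀ {n} → Edge n → List (Edge n) → List (Edge n)
without e = filter (λ f → ¬? (f ≟ₑ e))

length-without : ∀ {n} {e : Edge n} L → e ∈ₑ L → suc (length (without e L)) ≤ length L
length-without L e∈L = filter-notAll _ L (Any.map (λ e≈f f≉e → f≉e (SameEdge-sym e≈f)) e∈L)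

∈ₑ-without : ∀ {n} {e f : Edge n} {L} → f ∈ₑ L → ¬ SameEdge f e → f ∈ₑ without e L
∈ₑ-without {e = e} = ∈-filter⁺ (edgeSetoid _) (λ f → ¬? (f ≟ₑ e))
                               (λ f≈g f≉e g≈e → f≉e (SameEdge-trans f≈g g≈e))

AtMost : ∀ {n} → ℕ → (Edge n → Set) → Set
AtMost {n} c P = Σ (List (Edge n)) λ L → length L ≤ c × (∀ f → P f → f ∈ₑ L)

module _ {n : ℕ} {P : Edge n → Set} where

  AtMost-⊆ : ∀ {Q c} → (∀ f → Q f → P f) → AtMost c P → AtMost c Q
  AtMost-⊆ Q⊆P (L , len , cover) = L , len , λ f → cover f ∘ Q⊆P f

  AtMost-weaken : ∀ {c d} → c ≤ d → AtMost c P → AtMost d P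
  AtMost-weaken c≤d (L , len , cover) = L , ≤-trans len c≤d , cover

  AtMost-zero : AtMost 0 P → ∀ {f} → ¬ P f
  AtMost-zero ([] , _ , cover) {f} p with cover f p
  ... | ()

  AtMost-none : (∀ f → ¬ P f) → AtMost 0 P
  AtMost-none none = [] , z≤n , λ f p → ⊥-elim (none f p)

  AtMost-remove : ∀ {Q c e} → AtMost (suc c) P → P e →
                  (∀ f → Q f → P f × ¬ SameEdge f e) → AtMost c Q
  AtMost-remove {e = e} (L , len , cover) pe Q⊆P-e =
    without e L , ≤-pred (≤-trans (length-without L (cover e pe)) len) ,
    λ f qf → let (pf , f≉e) = Q⊆P-e f qf in ∈ₑ-without (cover f pf) f≉e

  AtMost-merge : ∀ {Q R c d e} → AtMost (suc c) P → AtMost (suc d) Q → P e → Q e →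
                 (∀ f → R f → (P f ⊎ Q f) × ¬ SameEdge f e) → AtMost (c + d) R
  AtMost-merge {R = R} {c} {d} {e} (L₁ , len₁ , cover₁) (L₂ , len₂ , cover₂) pe qe R⊆P∪Q-e =
    without e (L₁ ++ L₂) , len , cover
    where
    len : length (without e (L₁ ++ L₂)) ≤ c + d
    len = begin
      length (without e (L₁ ++ L₂))                ≡⟨ cong length (filter-++ _ L₁ L₂) ⟩
      length (without e L₁ ++ without e L₂)        ≡⟨ length-++ (without e L₁) ⟩
      length (without e L₁) + length (without e L₂)
        ≤⟨ +-mono-≤ (≤-pred (≤-trans (length-without L₁ (cover₁ e pe)) len₁))
                    (≤-pred (≤-trans (length-without L₂ (cover₂ e qe)) len₂)) ⟩
      c + d                                        ∎
      where open ≤-Reasoning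
    cover : ∀ f → R f → f ∈ₑ without e (L₁ ++ L₂)
    cover f rf with R⊆P∪Q-e f rf
    ... | inj₁ pf , f≉e = ∈ₑ-without (++⁺ˡ (cover₁ f pf)) f≉e
    ... | inj₂ qf , f≉e = ∈ₑ-without (++⁺ʳ L₁ (cover₂ f qf)) f≉e

support : ∀ {m} → (Fin m → Bool) → List (Fin m)
support {zero}  f = []
support {suc m} f with f zero
... | true  = zero ∷ map suc (support (f ∘ suc))
... | false = map suc (support (f ∘ suc))

length-support : ∀ {m} (f : Fin m → Bool) → length (support f) ≡ countF f
length-support {zero}  f = refl
length-support {suc m} f with f zero
... | true  = cong suc (trans (length-map suc (support (f ∘ suc))) (length-support (f ∘ suc)))
... | false = trans (length-map suc (support (f ∘ suc))) (length-support (f ∘ suc))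

∈-support : ∀ {m} (f : Fin m → Bool) {j} → f j ≡ true → j ∈ support f
∈-support {suc m} f {zero} fj with f zero
∈-support {suc m} f {zero} refl | true = here refl
∈-support {suc m} f {suc j} fj with f zero
... | true  = there (∈-map⁺ suc (∈-support (f ∘ suc) fj))
... | false = ∈-map⁺ suc (∈-support (f ∘ suc) fj)

IncidentIn : ∀ {n} → (Fin n → Fin n → Bool) → Fin n → Edge n → Set
IncidentIn H u (x , y) = H x y ≡ true × (u ≡ x ⊎ u ≡ y)

incident-AtMost-deg : ∀ {n} (H : Fin n → Fin n → Bool) → (∀ x y → H x y ≡ H y x) →
                      ∀ u → AtMost (deg H u) (IncidentIn H u)
incident-AtMost-deg H H-sym u =
  map (u ,_) (support (H u)) ,
  ≤-reflexive (trans (length-map (u ,_) (support (H u))) (length-support (H u))) ,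
  cover
  where
  cover : ∀ f → IncidentIn H u f → f ∈ₑ map (u ,_) (support (H u))
  cover (x , y) (h , inj₁ refl) = ∈⇒∈ₑ (∈-map⁺ (u ,_) (∈-support (H u) h))
  cover (x , y) (h , inj₂ refl) = ∈ₑ-swap (∈⇒∈ₑ (∈-map⁺ (u ,_) (∈-support (H u) (trans (H-sym u x) h))))

argmin-Fin : ∀ {k} (f : Fin (suc k) → ℕ) → Σ (Fin (suc k)) λ i → ∀ j → f i ≤ f j
argmin-Fin f = argmin f zero (allFin _) ,
               λ j → All.lookup (f[argmin]≤f[xs] {f = f} zero (allFin _)) (∈-allFin j)

csuc-surjective : ∀ {k} (i : Fin (suc k)) → Σ (Fin (suc k)) λ j → csuc j ≡ i
csuc-surjective {k} zero = fromℕ k , toℕ-injective (begin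
  toℕ (csuc (fromℕ k))          ≡⟨ toℕ-fromℕ< _ ⟩
  suc (toℕ (fromℕ k)) % suc k   ≡⟨ cong (λ t → suc t % suc k) (toℕ-fromℕ k) ⟩
  suc k % suc k                 ≡⟨ n%n≡0 (suc k) ⟩
  0                             ∎)
  where open ≡-Reasoning
csuc-surjective {suc k} (suc i) = inject₁ i , toℕ-injective (begin
  toℕ (csuc (inject₁ i))                  ≡⟨ toℕ-fromℕ< _ ⟩
  suc (toℕ (inject₁ i)) % suc (suc k)     ≡⟨ cong (λ t → suc t % suc (suc k)) (toℕ-inject₁ i) ⟩
  suc (toℕ i) % suc (suc k)               ≡⟨ m<n⇒m%n≡m (s≤s (toℕ<n i)) ⟩
  suc (toℕ i)                             ∎)
  where open ≡-Reasoning

module HComponents {n : ℕ} (adj : Fin n → Fin n → Bool) (b : ℕ) (ρ : Fin n → ℕ) where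
  open Game adj b ρ

  HReach-rank : ∀ {M x y} → HReach M x y → ρ x ≡ ρ y
  HReach-rank hhere            = refl
  HReach-rank (hstep r _ same) = trans (HReach-rank r) same

  HReach-trans : ∀ {M x y z} → HReach M x y → HReach M y z → HReach M x z
  HReach-trans r hhere            = r
  HReach-trans r (hstep s m same) = hstep (HReach-trans r s) m same

  HReach-edge : ∀ {M x y} → (x , y) ∈ₑ M → ρ x ≡ ρ y → HReach M x y
  HReach-edge = hstep hhere

  HReach-sym : ∀ {M x y} → HReach M x y → HReach M y x
  HReach-sym hhere            = hhere
  HReach-sym (hstep r m same) = HReach-trans (HReach-edge (∈ₑ-swap m) (sym same)) (HReach-sym r)

  HReach-∷ : ∀ {M e x y} → HReach M x y → HReach (e ∷ M) x y
  HReach-∷ hhere            = hhere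
  HReach-∷ (hstep r m same) = hstep (HReach-∷ r) (there m) same

  HReach-[] : ∀ {x y} → HReach [] x y → x ≡ y
  HReach-[] hhere = refl

  HReach-vertical : ∀ {M p q x y} → ρ p ≢ ρ q → HReach ((p , q) ∷ M) x y → HReach M x y
  HReach-vertical vert hhere = hhere
  HReach-vertical vert (hstep r (here (inj₁ (refl , refl))) same) = ⊥-elim (vert same)
  HReach-vertical vert (hstep r (here (inj₂ (refl , refl))) same) = ⊥-elim (vert (sym same))
  HReach-vertical vert (hstep r (there m) same) = hstep (HReach-vertical vert r) m same

  HReachVia : List (Edge n) → Fin n → Fin n → Fin n → Fin n → Set
  HReachVia M p q x z = HReach M x z ⊎ (HReach M x p × HReach M q z) ⊎ (HReach M x q × HReach M p z)

  HReach-split : ∀ {M p q x z} → HReach ((p , q) ∷ M) x z → HReachVia M p q x z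
  HReach-split hhere = inj₁ hhere
  HReach-split (hstep r (here (inj₁ (refl , refl))) _) with HReach-split r
  ... | inj₁ xp               = inj₂ (inj₁ (xp , hhere))
  ... | inj₂ (inj₁ (xp , qp)) = inj₁ (HReach-trans xp (HReach-sym qp))
  ... | inj₂ (inj₂ (xq , _))  = inj₁ xq
  HReach-split (hstep r (here (inj₂ (refl , refl))) _) with HReach-split r
  ... | inj₁ xq               = inj₂ (inj₂ (xq , hhere))
  ... | inj₂ (inj₁ (xp , _))  = inj₁ xp
  ... | inj₂ (inj₂ (xq , pq)) = inj₁ (HReach-trans xq (HReach-sym pq))
  HReach-split (hstep r (there m) same) with HReach-split r
  ... | inj₁ xy               = inj₁ (hstep xy m same)
  ... | inj₂ (inj₁ (xp , qy)) = inj₂ (inj₁ (xp , hstep qy m same))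
  ... | inj₂ (inj₂ (xq , py)) = inj₂ (inj₂ (xq , hstep py m same))

  HReach-join : ∀ {M p q x z} → ρ p ≡ ρ q → HReachVia M p q x z → HReach ((p , q) ∷ M) x z
  HReach-join _    (inj₁ xz)               = HReach-∷ xz
  HReach-join same (inj₂ (inj₁ (xp , qz))) =
    HReach-trans (HReach-∷ xp) (HReach-trans (HReach-edge (here SameEdge-refl) same) (HReach-∷ qz))
  HReach-join same (inj₂ (inj₂ (xq , pz))) =
    HReach-trans (HReach-∷ xq) (HReach-trans (HReach-edge (here SameEdge-swap) (sym same)) (HReach-∷ pz))

  HReach? : ∀ M x y → Dec (HReach M x y)
  HReach? [] x y = map′ (λ { refl → hhere }) HReach-[] (x Fin.≟ y)
  HReach? ((p , q) ∷ M) x y with ρ p ≟ ρ q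
  ... | yes same = map′ (HReach-join same) HReach-split
                        (HReach? M x y ⊎-dec (HReach? M x p ×-dec HReach? M q y)
                                       ⊎-dec (HReach? M x q ×-dec HReach? M p y))
  ... | no vert = map′ HReach-∷ (HReach-vertical vert) (HReach? M x y)

  horizontal-resp : ∀ {p q l h} → SameEdge (p , q) (l , h) → ρ l ≡ ρ h → ρ p ≡ ρ q
  horizontal-resp (inj₁ (refl , refl)) same = same
  horizontal-resp (inj₂ (refl , refl)) same = sym same

  vertical-resp : ∀ {p q l h} → SameEdge (p , q) (l , h) → ρ l ≢ ρ h → ρ p ≢ ρ q
  vertical-resp pq≈lh vert = vert ∘ horizontal-resp (SameEdge-sym pq≈lh)

  lower-end : ∀ {x y l h} → SameEdge (x , y) (l , h) → ρ x < ρ y → ρ l < ρ h → x ≡ l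
  lower-end (inj₁ (refl , _))    _   _   = refl
  lower-end (inj₂ (refl , refl)) h<l l<h = ⊥-elim (<-asym l<h h<l)

  UpFrom : List (Edge n) → Fin n → Edge n → Set
  UpFrom M u (x , y) = (x , y) ∈ₑ M × ρ x < ρ y × HReach M u x

  HasUp : List (Edge n) → Fin n → Set
  HasUp M u = Σ (Edge n) (UpFrom M u)

  UniqueUp : List (Edge n) → Set
  UniqueUp M = ∀ {u e f} → UpFrom M u e → UpFrom M u f → SameEdge e f

  UpFrom-resp : ∀ {M u v e} → HReach M u v → UpFrom M v e → UpFrom M u e
  UpFrom-resp uv (m , up , vx) = m , up , HReach-trans uv vx

  HasUp-resp : ∀ {M u v} → HReach M u v → HasUp M v → HasUp M u
  HasUp-resp uv (e , up) = e , UpFrom-resp uv up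

  HReach-enter : ∀ {M p q z} → HReach ((p , q) ∷ M) p z → HReach M p z ⊎ HReach M q z
  HReach-enter pz with HReach-split pz
  ... | inj₁ pz′              = inj₁ pz′
  ... | inj₂ (inj₁ (_ , qz))  = inj₂ qz
  ... | inj₂ (inj₂ (_ , pz′)) = inj₁ pz′

  HReach-avoid : ∀ {M p q u z} → ρ p ≡ ρ q → ¬ HReach ((p , q) ∷ M) p u →
                 HReach ((p , q) ∷ M) u z → HReach M u z
  HReach-avoid same far uz with HReach-split uz
  ... | inj₁ uz′             = uz′
  ... | inj₂ (inj₁ (up , _)) = ⊥-elim (far (HReach-sym (HReach-∷ up)))
  ... | inj₂ (inj₂ (uq , _)) =
        ⊥-elim (far (HReach-sym (HReach-trans (HReach-∷ uq) (HReach-edge (here SameEdge-swap) (sym same)))))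

  UpFrom-∷-vertical : ∀ {M p q l h u f} → SameEdge (p , q) (l , h) → ρ l < ρ h →
                      UpFrom ((p , q) ∷ M) u f → (SameEdge f (l , h) × HReach M u l) ⊎ UpFrom M u f
  UpFrom-∷-vertical {M} pq≈lh l<h (here f≈pq , up , ux) =
    inj₁ (f≈lh , subst (HReach M _) (lower-end f≈lh up l<h) (HReach-vertical (vertical-resp pq≈lh (<⇒≢ l<h)) ux))
    where f≈lh = SameEdge-trans f≈pq pq≈lh
  UpFrom-∷-vertical pq≈lh l<h (there m , up , ux) =
    inj₂ (m , up , HReach-vertical (vertical-resp pq≈lh (<⇒≢ l<h)) ux)

  UniqueUp-∷-vertical : ∀ {M p q l h} → SameEdge (p , q) (l , h) → ρ l < ρ h →
                        ¬ HasUp M l → UniqueUp M → UniqueUp ((p , q) ∷ M)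
  UniqueUp-∷-vertical pq≈lh l<h no-up unique up₁ up₂
    with UpFrom-∷-vertical pq≈lh l<h up₁ | UpFrom-∷-vertical pq≈lh l<h up₂
  ... | inj₁ (f≈lh , _) | inj₁ (g≈lh , _) = SameEdge-trans f≈lh (SameEdge-sym g≈lh)
  ... | inj₁ (_ , ul)   | inj₂ old       = ⊥-elim (no-up (_ , UpFrom-resp (HReach-sym ul) old))
  ... | inj₂ old        | inj₁ (_ , ul)  = ⊥-elim (no-up (_ , UpFrom-resp (HReach-sym ul) old))
  ... | inj₂ old₁       | inj₂ old₂      = unique old₁ old₂

  HasUp-∷-vertical : ∀ {M p q l h u} → SameEdge (p , q) (l , h) → ρ l < ρ h →
                     ¬ HReach ((p , q) ∷ M) l u → HasUp ((p , q) ∷ M) u → HasUp M u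
  HasUp-∷-vertical pq≈lh l<h far (f , up) with UpFrom-∷-vertical pq≈lh l<h up
  ... | inj₁ (_ , ul) = ⊥-elim (far (HReach-∷ (HReach-sym ul)))
  ... | inj₂ old      = f , old

  UpFrom-∷-horizontal : ∀ {M p q u f} → ρ p ≡ ρ q → ¬ HasUp M p → ¬ HasUp M q →
                        UpFrom ((p , q) ∷ M) u f → UpFrom M u f
  UpFrom-∷-horizontal same _ _ (here f≈pq , up , _) = ⊥-elim (<⇒≢ up (horizontal-resp f≈pq same))
  UpFrom-∷-horizontal {f = f} same no-up-p no-up-q (there m , up , ux) with HReach-split ux
  ... | inj₁ ux′             = m , up , ux′
  ... | inj₂ (inj₁ (_ , qx)) = ⊥-elim (no-up-q (f , m , up , qx))
  ... | inj₂ (inj₂ (_ , px)) = ⊥-elim (no-up-p (f , m , up , px))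

  data Ascent (M : List (Edge n)) : Fin n → Fin n → ℕ → Set where
    flat  : ∀ {x y} → HReach M x y → Ascent M x y 0
    climb : ∀ {x x′ z y k} → UpFrom M x (x′ , z) → Ascent M z y k → Ascent M x y (suc k)

  Ascent-rank : ∀ {M x y k} → Ascent M x y k → k + ρ x ≤ ρ y
  Ascent-rank (flat xy) = ≤-reflexive (HReach-rank xy)
  Ascent-rank {x = x} {y} (climb {x′ = x′} {z} {k = k} (_ , up , xx′) a) = begin
    suc k + ρ x    ≡⟨ sym (+-suc k (ρ x)) ⟩
    k + suc (ρ x)  ≡⟨ cong (λ t → k + suc t) (HReach-rank xx′) ⟩
    k + suc (ρ x′) ≤⟨ +-monoʳ-≤ k up ⟩
    k + ρ z        ≤⟨ Ascent-rank a ⟩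
    ρ y            ∎
    where open ≤-Reasoning

  Ascent-prepend : ∀ {M w x y k} → HReach M w x → Ascent M x y k → Ascent M w y k
  Ascent-prepend wx (flat xy)   = flat (HReach-trans wx xy)
  Ascent-prepend wx (climb u a) = climb (UpFrom-resp wx u) a

  TWalk-prepend : ∀ {M w x y k} → HReach M w x → TWalk M x y k → TWalk M w y k
  TWalk-prepend wx (there0 xy)          = there0 (HReach-trans wx xy)
  TWalk-prepend wx (tstep xx′ m vert t) = tstep (HReach-trans wx xx′) m vert t

  TWalk-++ : ∀ {M x y z k j} → TWalk M x y k → TWalk M y z j → TWalk M x z (k + j)
  TWalk-++ (there0 xy)          t = TWalk-prepend xy t
  TWalk-++ (tstep xx′ m vert s) t = tstep xx′ m vert (TWalk-++ s t)

  TWalk-snoc : ∀ {M x y y′ z w k} → TWalk M x y k → HReach M y y′ → (y′ , z) ∈ₑ M → ρ y′ ≢ ρ z →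
               HReach M z w → TWalk M x w (suc k)
  TWalk-snoc (there0 xy)          yy′ m vert zw = tstep (HReach-trans xy yy′) m vert (there0 zw)
  TWalk-snoc (tstep xx′ m′ vert′ t) yy′ m vert zw = tstep xx′ m′ vert′ (TWalk-snoc t yy′ m vert zw)

  Ascent⇒TWalk : ∀ {M x y k} → Ascent M x y k → TWalk M x y k
  Ascent⇒TWalk (flat xy)                = there0 xy
  Ascent⇒TWalk (climb (m , up , xx′) a) = tstep xx′ m (<⇒≢ up) (Ascent⇒TWalk a)

  Ascent⇒TWalk-reverse : ∀ {M x y k} → Ascent M x y k → TWalk M y x k
  Ascent⇒TWalk-reverse (flat xy) = there0 (HReach-sym xy)
  Ascent⇒TWalk-reverse (climb (m , up , xx′) a) =
    TWalk-snoc (Ascent⇒TWalk-reverse a) hhere (∈ₑ-swap m) (>⇒≢ up) (HReach-sym xx′)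

  module _ {M : List (Edge n)} (unique : UniqueUp M) where

    module _ {c0 : Fin n} (top : ∀ w → MReach M c0 w → ρ w ≤ ρ c0) where

      -- Every vertex of Γ climbs to the H-comp of c0: the only edge above an H-comp must be taken.
      ascend : ∀ {w} → MReach M c0 w → Σ ℕ (Ascent M w c0)
      ascend mhere = 0 , flat hhere
      ascend (mstep {y = y} {z} r m) with ascend r | <-cmp (ρ y) (ρ z)
      ... | k , a | tri≈ _ same _ = k , Ascent-prepend (HReach-edge (∈ₑ-swap m) (sym same)) a
      ... | k , a | tri> _ _ down = suc k , climb (∈ₑ-swap m , down , hhere) a
      ... | zero , flat yc0 | tri< up _ _ =
            ⊥-elim (<⇒≱ up (≤-trans (top z (mstep r m)) (≤-reflexive (sym (HReach-rank yc0)))))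
      ... | suc k , climb next@(_ , up′ , _) a | tri< up _ _ with unique (m , up , hhere) next
      ...   | inj₁ (refl , refl) = k , a
      ...   | inj₂ (refl , refl) = ⊥-elim (<-asym up up′)

      TΓ-connected : ∀ x y → MReach M c0 x → MReach M c0 y → Σ ℕ (TWalk M x y)
      TΓ-connected x y rx ry with ascend rx | ascend ry
      ... | kx , ax | ky , ay = kx + ky , TWalk-++ (Ascent⇒TWalk ax) (Ascent⇒TWalk-reverse ay)

      TΓ-height : HeightAtMost M c0 (ρ c0)
      TΓ-height w rw with ascend rw
      ... | k , a = k , ≤-trans (m≤m+n k (ρ w)) (Ascent-rank a) , Ascent⇒TWalk-reverse a

    -- In a cycle, the H-comp of least rank has two distinct edges above it.
    TΓ-acyclic : ∀ {c0} → ¬ Cycle M c0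
    TΓ-acyclic (k , es , _ , mem , vert , link , distinct , _) = two-edges-above-least
      where
      X Y : Fin (suc k) → Fin n
      X i = proj₁ (es i)
      Y i = proj₂ (es i)
      i = proj₁ (argmin-Fin (ρ ∘ X))
      least = proj₂ (argmin-Fin (ρ ∘ X))
      j = proj₁ (csuc-surjective i)
      Yj~Xi : HReach M (Y j) (X i)
      Yj~Xi = subst (λ t → HReach M (Y j) (X t)) (proj₂ (csuc-surjective i)) (link j)
      into : UpFrom M (X i) (Y j , X j)
      into = ∈ₑ-swap (mem j) ,
             ≤∧≢⇒< (≤-trans (≤-reflexive (HReach-rank Yj~Xi)) (least j)) (vert j ∘ sym) ,
             HReach-sym Yj~Xi
      out : UpFrom M (X i) (X i , Y i)
      out = mem i , ≤∧≢⇒< (≤-trans (least (csuc i)) (≤-reflexive (sym (HReach-rank (link i))))) (vert i) , hhere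
      two-edges-above-least : ⊥
      two-edges-above-least with i Fin.≟ j
      ... | yes i≡j = vert i (sym (HReach-rank (subst (λ t → HReach M (Y t) (X i)) (sym i≡j) Yj~Xi)))
      ... | no i≢j  = distinct j i (i≢j ∘ sym) (SameEdge-trans SameEdge-swap (unique into out))

module StrategyInvariant {n : ℕ} (adj : Fin n → Fin n → Bool) (b : ℕ) (ρ : Fin n → ℕ)
  (adj-sym : ∀ x y → adj x y ≡ adj y x) (rank : ∀ v → Peel.IsRank adj b v (ρ v)) where
  open Peel adj b
  open Game adj b ρ
  open HComponents adj b ρ

  peel-sym : ∀ t x y → peel t x y ≡ peel t y x
  peel-sym zero    x y = adj-sym x y
  peel-sym (suc t) x y = cong₂ _∧_ (peel-sym t x y) (∧-comm (2 + b ≤ᵇ deg (peel t) x) _)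

  peel-alive : ∀ t {x y} → adj x y ≡ true → t ≤ ρ x → t ≤ ρ y → peel t x y ≡ true
  peel-alive zero    a _ _ = a
  peel-alive (suc t) {x} {y} a tx ty
    rewrite peel-alive t a (<⇒≤ tx) (<⇒≤ ty)
          | Equivalence.to T-≡ (≤⇒≤ᵇ (proj₂ (rank x) t tx))
          | Equivalence.to T-≡ (≤⇒≤ᵇ (proj₂ (rank y) t ty)) = refl

  low-≤ : ∀ {p q} → ρ p ≤ ρ q → low (p , q) ≡ p
  low-≤ {p} {q} p≤q with ρ p ≤ᵇ ρ q | ≤⇒≤ᵇ p≤q
  ... | true | _ = refl

  low-> : ∀ {p q} → ρ q < ρ p → low (p , q) ≡ q
  low-> {p} {q} q<p with ρ p ≤ᵇ ρ q in p≤ᵇq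
  ... | true  = ⊥-elim (<⇒≱ q<p (≤ᵇ⇒≤ (ρ p) (ρ q) (subst T (sym p≤ᵇq) tt)))
  ... | false = refl

  Free-resp : ∀ {M B u v x y} → SameEdge (u , v) (x , y) → Free M B (u , v) → Free M B (x , y)
  Free-resp (inj₁ (refl , refl)) free = free
  Free-resp {u = u} {v} (inj₂ (refl , refl)) (a , ∉M , ∉B) =
    trans (adj-sym v u) a , ∉M ∘ ∈ₑ-swap , ∉B ∘ ∈ₑ-swap

  Free-∷ : ∀ {M B e f} → Free (e ∷ M) B f → Free M B f
  Free-∷ (a , ∉M , ∉B) = a , ∉M ∘ there , ∉B

  FC-resp : ∀ {M B u v f} → HReach M u v → FC M B u f → FC M B v f
  FC-resp uv (free , alive , inc) =
    free , subst (λ t → peel t _ _ ≡ true) (HReach-rank uv) alive ,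
    Sum.map (HReach-trans (HReach-sym uv)) (HReach-trans (HReach-sym uv)) inc

  FC-claimed : ∀ {M B e u f} → FC M (e ∷ B) u f → FC M B u f
  FC-claimed ((a , ∉M , ∉B) , alive , inc) = (a , ∉M , ∉B ∘ there) , alive , inc

  FC-claimed-≉ : ∀ {M B e u f} → FC M (e ∷ B) u f → ¬ SameEdge f e
  FC-claimed-≉ ((_ , _ , ∉B) , _) = ∉B ∘ here

  FC-∷-≉ : ∀ {M B e u f} → FC (e ∷ M) B u f → ¬ SameEdge f e
  FC-∷-≉ ((_ , ∉M , _) , _) = ∉M ∘ here

  FC-∷-vertical : ∀ {M B p q u f} → ρ p ≢ ρ q → FC ((p , q) ∷ M) B u f → FC M B u f
  FC-∷-vertical vert (free , alive , inc) =
    Free-∷ free , alive , Sum.map (HReach-vertical vert) (HReach-vertical vert) inc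

  FC-∷-avoid : ∀ {M B p q u f} → ρ p ≡ ρ q → ¬ HReach ((p , q) ∷ M) p u →
               FC ((p , q) ∷ M) B u f → FC M B u f
  FC-∷-avoid same far (free , alive , inc) =
    Free-∷ free , alive , Sum.map (HReach-avoid same far) (HReach-avoid same far) inc

  FC-∷-merge : ∀ {M B p q f} → ρ p ≡ ρ q → FC ((p , q) ∷ M) B p f → FC M B p f ⊎ FC M B q f
  FC-∷-merge same (free , alive , inj₁ px) with HReach-enter px
  ... | inj₁ px′ = inj₁ (Free-∷ free , alive , inj₁ px′)
  ... | inj₂ qx  = inj₂ (Free-∷ free , subst (λ t → peel t _ _ ≡ true) same alive , inj₁ qx)
  FC-∷-merge same (free , alive , inj₂ py) with HReach-enter py
  ... | inj₁ py′ = inj₁ (Free-∷ free , alive , inj₂ py′)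
  ... | inj₂ qy  = inj₂ (Free-∷ free , subst (λ t → peel t _ _ ≡ true) same alive , inj₂ qy)

  -- The paper's invariant: |F(C)| ≤ b + 1, and F(C) = ∅ once an edge above C is claimed by Maker;
  -- k is the allowance of the H-comp Breaker is still working on (k of his steps are left).
  Budget : List (Edge n) → List (Edge n) → Fin n → ℕ → Set
  Budget M B u k = AtMost (k + suc b) (FC M B u) × (HasUp M u → AtMost k (FC M B u))

  Budget-mono : ∀ {M B M′ B′ u v k} → (∀ f → FC M′ B′ v f → FC M B u f) → (HasUp M′ v → HasUp M u) →
                Budget M B u k → Budget M′ B′ v k
  Budget-mono F′⊆F up′⇒up (bound , bound-up) =
    AtMost-⊆ F′⊆F bound , λ up → AtMost-⊆ F′⊆F (bound-up (up′⇒up up))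

  Budget-resp : ∀ {M B u v k} → HReach M u v → Budget M B u k → Budget M B v k
  Budget-resp uv = Budget-mono (λ _ → FC-resp (HReach-sym uv)) (HasUp-resp uv)

  Budget-claimed : ∀ {M B e u k} → Budget M B u k → Budget M (e ∷ B) u k
  Budget-claimed = Budget-mono (λ _ → FC-claimed) (λ up → up)

  Settled : List (Edge n) → List (Edge n) → Set
  Settled M B = UniqueUp M × (∀ u → Budget M B u 0)

  Pending : List (Edge n) → List (Edge n) → Fin n → ℕ → Set
  Pending M B l k = UniqueUp M × (∀ u → ¬ HReach M l u → Budget M B u 0) × Budget M B l k

  settled-initial : Settled [] []
  settled-initial = (λ { {e = _ , _} (() , _) _ }) , λ u →
    AtMost-weaken (≤-pred (proj₁ (rank u)))
      (AtMost-⊆ incident (incident-AtMost-deg (peel (ρ u)) (peel-sym (ρ u)) u)) ,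
    λ { (_ , () , _) }
    where
    incident : ∀ {u} f → FC [] [] u f → IncidentIn (peel (ρ u)) u f
    incident (x , y) (_ , alive , inc) = alive , Sum.map HReach-[] HReach-[] inc

  AtMost-claim : ∀ {M B e l c} → AtMost (suc c) (FC M B l) → FC M B l e ⊎ (∀ g → ¬ FC M B l g) →
                 AtMost c (FC M (e ∷ B) l)
  AtMost-claim a (inj₁ e∈F) = AtMost-remove a e∈F (λ _ fc → FC-claimed fc , FC-claimed-≉ fc)
  AtMost-claim a (inj₂ none) = AtMost-weaken z≤n (AtMost-none (λ g → none g ∘ FC-claimed))

  Budget-step : ∀ {M B e l k} → Budget M B l (suc k) → FC M B l e ⊎ (∀ g → ¬ FC M B l g) →
                Budget M (e ∷ B) l k
  Budget-step (bound , bound-up) choice =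
    AtMost-claim bound choice , λ up → AtMost-claim (bound-up up) choice

  breaker-step : ∀ {M B e l k} → Pending M B l (suc k) → FC M B l e ⊎ (∀ g → ¬ FC M B l g) →
                 Pending M (e ∷ B) l k
  breaker-step (unique , others , budget) choice =
    unique , (λ u far → Budget-claimed (others u far)) , Budget-step budget choice

  SB-claims-from-F : ∀ {M B m e} → SB M B m e → FC M B (low m) e ⊎ (∀ g → ¬ FC M B (low m) g)
  SB-claims-from-F (inj₁ (fc , _))               = inj₁ fc
  SB-claims-from-F (inj₂ (inj₁ (_ , fc , _)))    = inj₁ fc
  SB-claims-from-F (inj₂ (inj₂ (noV , noH , _))) = inj₂ λ { (x , y) fc → classify fc (ρ x ≟ ρ y) }
    where
    classify : ∀ {x y} → FC _ _ _ (x , y) → Dec (ρ x ≡ ρ y) → ⊥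
    classify fc (yes same) = noH (_ , fc , same)
    classify fc (no vert)  = noV (_ , fc , vert)

  pending-settle : ∀ {M B l} → Pending M B l 0 → Settled M B
  pending-settle {M} {l = l} (unique , others , budget) = unique , settle
    where
    settle : ∀ u → Budget _ _ u 0
    settle u with HReach? M l u
    ... | yes lu = Budget-resp lu budget
    ... | no far = others u far

  -- A claimed edge lies in F of both endpoints' H-comps, so neither of them has an edge above it yet.
  add-vertical : ∀ {M B p q l h} → SameEdge (p , q) (l , h) → ρ l < ρ h →
                 Settled M B → Free M B (p , q) → Pending ((p , q) ∷ M) B l b
  add-vertical {M} {B} {p} {q} {l} {h} pq≈lh l<h (unique , budget) free =
    UniqueUp-∷-vertical pq≈lh l<h no-up unique ,
    (λ u far → Budget-mono (λ _ → FC-∷-vertical vert) (HasUp-∷-vertical pq≈lh l<h far) (budget u)) ,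
    AtMost-weaken (m≤m+n b (suc b)) Fl′ , λ _ → Fl′
    where
    vert : ρ p ≢ ρ q
    vert = vertical-resp pq≈lh (<⇒≢ l<h)
    lh-free : Free M B (l , h)
    lh-free = Free-resp pq≈lh free
    lh∈Fl : FC M B l (l , h)
    lh∈Fl = lh-free , peel-alive (ρ l) (proj₁ lh-free) ≤-refl (<⇒≤ l<h) , inj₁ hhere
    no-up : ¬ HasUp M l
    no-up up = AtMost-zero (proj₂ (budget l) up) lh∈Fl
    Fl′ : AtMost b (FC ((p , q) ∷ M) B l)
    Fl′ = AtMost-remove (proj₁ (budget l)) lh∈Fl
            (λ f fc → FC-∷-vertical vert fc , λ f≈lh → FC-∷-≉ fc (SameEdge-trans f≈lh (SameEdge-sym pq≈lh)))

  add-horizontal : ∀ {M B p q} → ρ p ≡ ρ q → Settled M B → Free M B (p , q) → Pending ((p , q) ∷ M) B p b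
  add-horizontal {M} {B} {p} {q} same (unique , budget) free =
    (λ up₁ up₂ → unique (old-up up₁) (old-up up₂)) ,
    (λ u far → Budget-mono (λ _ → FC-∷-avoid same far) (λ (f , up) → f , old-up up) (budget u)) ,
    AtMost-weaken (+-monoʳ-≤ b (n≤1+n b)) Fp′ , λ (f , up) → ⊥-elim (no-up-p (f , old-up up))
    where
    pq∈Fp : FC M B p (p , q)
    pq∈Fp = free , peel-alive (ρ p) (proj₁ free) ≤-refl (≤-reflexive same) , inj₁ hhere
    pq∈Fq : FC M B q (p , q)
    pq∈Fq = free , peel-alive (ρ q) (proj₁ free) (≤-reflexive (sym same)) ≤-refl , inj₂ hhere
    no-up-p : ¬ HasUp M p
    no-up-p up = AtMost-zero (proj₂ (budget p) up) pq∈Fp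
    no-up-q : ¬ HasUp M q
    no-up-q up = AtMost-zero (proj₂ (budget q) up) pq∈Fq
    old-up : ∀ {u f} → UpFrom ((p , q) ∷ M) u f → UpFrom M u f
    old-up = UpFrom-∷-horizontal same no-up-p no-up-q
    Fp′ : AtMost (b + b) (FC ((p , q) ∷ M) B p)
    Fp′ = AtMost-merge (proj₁ (budget p)) (proj₁ (budget q)) pq∈Fp pq∈Fq
            (λ f fc → FC-∷-merge same fc , FC-∷-≉ fc)

  maker-move : ∀ {M B p q} → Settled M B → Free M B (p , q) → Pending ((p , q) ∷ M) B (low (p , q)) b
  maker-move {p = p} {q} settled free with <-cmp (ρ p) (ρ q)
  ... | tri< p<q _ _  rewrite low-≤ (<⇒≤ p<q)         = add-vertical SameEdge-refl p<q settled free
  ... | tri≈ _ same _ rewrite low-≤ (≤-reflexive same) = add-horizontal same settled free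
  ... | tri> _ _ q<p  rewrite low-> q<p                = add-vertical SameEdge-swap q<p settled free

  Invariant : List (Edge n) → List (Edge n) → Phase → Set
  Invariant M B makerTurn         = Settled M B
  Invariant M B (breakerTurn m k) = Pending M B (low m) k

  reachable-invariant : ∀ {M B ph} → Reachable M B ph → Invariant M B ph
  reachable-invariant init                      = settled-initial
  reachable-invariant (mk r free)               = maker-move (reachable-invariant r) free
  reachable-invariant (bk {k = zero} r _ move)  =
    pending-settle (breaker-step (reachable-invariant r) (SB-claims-from-F move))
  reachable-invariant (bk {k = suc k} r _ move) = breaker-step (reachable-invariant r) (SB-claims-from-F move)

  reachable⇒UniqueUp : ∀ {M B ph} → Reachable M B ph → UniqueUp M
  reachable⇒UniqueUp {ph = makerTurn}       r = proj₁ (reachable-invariant r)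
  reachable⇒UniqueUp {ph = breakerTurn _ _} r = proj₁ (reachable-invariant r)

corollary10 : (n b : ℕ) (adj : Fin n → Fin n → Bool) → 1 ≤ b
    → (∀ x y → adj x y ≡ adj y x) → (∀ x → adj x x ≡ false)
    → Peel.Degenerate adj b
    → (ρ : Fin n → ℕ) → (∀ v → Peel.IsRank adj b v (ρ v))
    → (M B : List (Edge n)) (ph : Game.Phase adj b ρ)
    → Game.Reachable adj b ρ M B ph
    → (c0 : Fin n) → (∀ w → Game.MReach adj b ρ M c0 w → ρ w ≤ ρ c0)
    → Game.IsTreeTΓ adj b ρ M c0 × Game.HeightAtMost adj b ρ M c0 (ρ c0)
corollary10 n b adj _ adj-sym _ _ ρ rank M B ph reachable c0 top =
  (TΓ-connected unique top , TΓ-acyclic unique) , TΓ-height unique top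
  where
  open HComponents adj b ρ
  unique : UniqueUp M
  unique = StrategyInvariant.reachable⇒UniqueUp adj b ρ adj-sym rank reachable
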